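{- There exist absolute constants $0<c\le C$ such that for all integers $n,m\ge1$: if $m\le\sqrt n$ then $c\sqrt n\le b(C_{n,m})\le C\sqrt n$; if $\sqrt n\le m\le n$ then $c\,m\le b(C_{n,m})\le C\,m$; if $n\le m$ then $c\sqrt{nm}\le b(C_{n,m})\le C\sqrt{nm}$. That is, $b(C_{n,m})=\Theta(\sqrt n)$, $\Theta(m)$, $\Theta(\sqrt{nm})$ in the three respective regimes.
   Context: The burning number of a graph $G$ is $b(G)=\min\{k : \exists v_1,\dots,v_k\in V(G) \text{ with } V(G)=\bigcup_{i=1}^k B(v_i,k-i)\}$, where $B(v,r)$ is the set of vertices at graph distance at most $r$ from $v$. The comb graph $C_{n,m}$ has vertex set $\{(i,j): 1\le i\le m,\ 1\le j\le n\}$ with edges $(1,j)\sim(1,j+1)$ for $1\le j<n$ (the spine) and $(i,j)\sim(i+1,j)$ for $1\le i<m$ (tooth $j$). -}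

module Defs where

open import Data.Nat using (ℕ; zero; suc; _+_; _*_; _∸_; _<_; _≤_)
open import Data.Fin using (Fin; toℕ)
open import Data.Product using (_×_; _,_; ∃; Σ)
open import Data.Sum using (_⊎_)
open import Relation.Binary.PropositionalEquality using (_≡_)
open import Relation.Nullary using (¬_)

-- Vertices of the comb C_{n,m}: (i , j) with i : Fin m (position on tooth,
-- 0-indexed; i = 0 is the spine) and j : Fin n (which tooth, 0-indexed).
-- Paper's (i,j) with 1 ≤ i ≤ m, 1 ≤ j ≤ n corresponds to (i-1 , j-1).
CombV : ℕ → ℕ → Set
CombV n m = Fin m × Fin n

data CombEdge (n m : ℕ) : CombV n m → CombV n m → Set where
  spine : (s : Fin m) (j j' : Fin n) → toℕ s ≡ 0 → suc (toℕ j) ≡ toℕ j' →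
          CombEdge n m (s , j) (s , j')
  tooth : (i i' : Fin m) (j : Fin n) → suc (toℕ i) ≡ toℕ i' →
          CombEdge n m (i , j) (i' , j)

CombAdj : (n m : ℕ) → CombV n m → CombV n m → Set
CombAdj n m u v = CombEdge n m u v ⊎ CombEdge n m v u

data Within (n m : ℕ) : CombV n m → CombV n m → ℕ → Set where
  here : ∀ {u r} → Within n m u u r
  step : ∀ {u w v r} → CombAdj n m u w → Within n m w v r → Within n m u v (suc r)

-- A burning sequence of length k: v_1,…,v_k (0-indexed here as v 0 … v (k-1))
-- with V = ⋃_{i=1}^k B(v_i , k - i).  For 0-indexed t, radius is k - (t+1).
Burns : (n m k : ℕ) → Set
Burns n m k = Σ (Fin k → CombV n m) λ v →
  (u : CombV n m) → ∃ λ (t : Fin k) → Within n m (v t) u (k ∸ suc (toℕ t))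

IsBurningNumber : (n m b : ℕ) → Set
IsBurningNumber n m b = Burns n m b × (∀ k → k < b → ¬ Burns n m k)

-- Lower bounds: along a walk the tooth index and the depth each change by at most 1 per
-- step, and a walk that changes tooth must pass through the spine.  Hence a source of
-- radius r < b covers an interval of fewer than 2b spine vertices, and any vertex of depth
-- at least b only from its own tooth, within a depth interval of fewer than 2b.  Listing
-- the deep vertices tooth by tooth, both facts become a covering of an initial segment of
-- ℕ by b intervals of bounded length: n ≤ 2b² and n (m − b) ≤ 4b²; the latter gives
-- nm ≤ 6b² whenever m > 3b.
-- Upper bounds: with S ≈ √n sources spaced S apart on the spine, or with sources spaced
-- S ≈ √(nm) apart on every tooth, plus S padding rounds, everything burns within 3S rounds.
module Submission where

open import Defs
open import Data.Bool using (Bool; true; false; if_then_else_; _∨_; T)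
open import Data.Bool.Properties using (T-∨)
open import Data.Empty using (⊥; ⊥-elim)
open import Data.Fin using (Fin; toℕ; fromℕ<; splitAt; _↑ˡ_; remQuot; combine; zero; suc)
open import Data.Fin.Properties using (toℕ-injective; toℕ-fromℕ<; toℕ<n; splitAt-↑ˡ; toℕ-↑ˡ; remQuot-combine)
open import Data.Nat using (ℕ; zero; suc; _+_; _*_; _∸_; _≤_; _<_; z≤n; s≤s; ∣_-_∣; _<ᵇ_; NonZero; >-nonZero)
open import Data.Nat.DivMod using (_/_; _%_; m≡m%n+[m/n]*n; m%n<n; m/n*n≤m; m<n*o⇒m/o<n)
open import Data.Nat.Properties
open import Data.Nat.Tactic.RingSolver using (solve-∀)
open import Data.Product using (∃; ∃-syntax; _×_; _,_; proj₁; proj₂)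
open import Data.Sum using (inj₁; inj₂; [_,_]′)
open import Function using (_∘_)
open import Function.Bundles using (Equivalence)
open import Relation.Nullary using (yes; no; contradiction)
open import Relation.Binary.PropositionalEquality

-- Walks in the comb

module _ {n m : ℕ} where

  depthOf toothOf : CombV n m → ℕ
  depthOf = toℕ ∘ proj₁
  toothOf = toℕ ∘ proj₂

  ∣-∣-refl≤1 : ∀ x → ∣ x - x ∣ ≤ 1
  ∣-∣-refl≤1 x = ≤-trans (≤-reflexive (∣n-n∣≡0 x)) z≤n

  ∣-∣-suc≤1 : ∀ {x y} → suc x ≡ y → ∣ x - y ∣ ≤ 1
  ∣-∣-suc≤1 {zero}  refl = ≤-refl
  ∣-∣-suc≤1 {suc x} refl = ∣-∣-suc≤1 {x} refl

  CombEdge-∣toothOf∣≤1 : ∀ {u w} → CombEdge n m u w → ∣ toothOf u - toothOf w ∣ ≤ 1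
  CombEdge-∣toothOf∣≤1 (spine _ _ _ _ e) = ∣-∣-suc≤1 e
  CombEdge-∣toothOf∣≤1 (tooth _ _ j _)   = ∣-∣-refl≤1 (toℕ j)

  CombEdge-∣depthOf∣≤1 : ∀ {u w} → CombEdge n m u w → ∣ depthOf u - depthOf w ∣ ≤ 1
  CombEdge-∣depthOf∣≤1 (spine s _ _ _ _) = ∣-∣-refl≤1 (toℕ s)
  CombEdge-∣depthOf∣≤1 (tooth _ _ _ e)   = ∣-∣-suc≤1 e

  Within-∣-∣≤ : (f : CombV n m → ℕ) → (∀ {u w} → CombEdge n m u w → ∣ f u - f w ∣ ≤ 1) →
                ∀ {u v r} → Within n m u v r → ∣ f u - f v ∣ ≤ r
  Within-∣-∣≤ f edge≤1 {u} here = ≤-trans (≤-reflexive (∣n-n∣≡0 (f u))) z≤n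
  Within-∣-∣≤ f edge≤1 {u} {v} (step {w = w} adj walk) =
    ≤-trans (∣-∣-triangle (f u) (f w) (f v)) (+-mono-≤ (adj≤1 adj) (Within-∣-∣≤ f edge≤1 walk))
    where
    adj≤1 : CombAdj n m u w → ∣ f u - f w ∣ ≤ 1
    adj≤1 (inj₁ e) = edge≤1 e
    adj≤1 (inj₂ e) = subst (_≤ 1) (∣-∣-comm (f w) (f u)) (edge≤1 e)

  Within-∣toothOf∣≤ : ∀ {u v r} → Within n m u v r → ∣ toothOf u - toothOf v ∣ ≤ r
  Within-∣toothOf∣≤ = Within-∣-∣≤ toothOf CombEdge-∣toothOf∣≤1

  Within-∣depthOf∣≤ : ∀ {u v r} → Within n m u v r → ∣ depthOf u - depthOf v ∣ ≤ r
  Within-∣depthOf∣≤ = Within-∣-∣≤ depthOf CombEdge-∣depthOf∣≤1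

  CombAdj-acrossTeeth⇒onSpine : ∀ {u w} → CombAdj n m u w → toothOf u ≢ toothOf w → depthOf w ≡ 0
  CombAdj-acrossTeeth⇒onSpine (inj₁ (spine _ _ _ s≡0 _)) _ = s≡0
  CombAdj-acrossTeeth⇒onSpine (inj₂ (spine _ _ _ s≡0 _)) _ = s≡0
  CombAdj-acrossTeeth⇒onSpine (inj₁ (tooth _ _ _ _))     u≢w = ⊥-elim (u≢w refl)
  CombAdj-acrossTeeth⇒onSpine (inj₂ (tooth _ _ _ _))     u≢w = ⊥-elim (u≢w refl)

  Within-acrossTeeth⇒depth< : ∀ {u v r} → Within n m u v r → toothOf u ≢ toothOf v → depthOf v < r
  Within-acrossTeeth⇒depth< here u≢v = contradiction refl u≢v
  Within-acrossTeeth⇒depth< {v = v} (step {w = w} adj walk) u≢v with toothOf w ≟ toothOf v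
  ... | no w≢v = m<n⇒m<1+n (Within-acrossTeeth⇒depth< walk w≢v)
  ... | yes w≡v = s≤s (subst (λ d → ∣ d - depthOf v ∣ ≤ _)
                        (CombAdj-acrossTeeth⇒onSpine adj (λ u≡w → u≢v (trans u≡w w≡v)))
                        (Within-∣depthOf∣≤ walk))

  Within-mono : ∀ {u v r r′} → Within n m u v r → r ≤ r′ → Within n m u v r′
  Within-mono here               _         = here
  Within-mono (step adj walk) (s≤s r≤r′) = step adj (Within-mono walk r≤r′)

  Within-++ : ∀ {u w v r₁ r₂} → Within n m u w r₁ → Within n m w v r₂ → Within n m u v (r₁ + r₂)
  Within-++ here            walk₂ = Within-mono walk₂ (m≤n+m _ _)
  Within-++ (step adj walk₁) walk₂ = step adj (Within-++ walk₁ walk₂)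

  climb : ∀ d (j : Fin n) (i₀ i : Fin m) → toℕ i ≡ toℕ i₀ + d → Within n m (i₀ , j) (i , j) d
  climb zero j i₀ i i≡ =
    subst (λ x → Within n m (i₀ , j) (x , j) 0) (toℕ-injective (trans (sym (+-identityʳ _)) (sym i≡))) here
  climb (suc d) j i₀ i i≡ =
    step (inj₁ (tooth i₀ i₁ j (sym i₁≡))) (climb d j i₁ i (trans i≡ (trans (+-suc _ d) (cong (_+ d) (sym i₁≡)))))
    where
    i₀<m : suc (toℕ i₀) < m
    i₀<m = ≤-<-trans (subst (suc (toℕ i₀) ≤_) (sym (trans i≡ (+-suc (toℕ i₀) d))) (s≤s (m≤m+n (toℕ i₀) d))) (toℕ<n i)
    i₁ : Fin m
    i₁ = fromℕ< i₀<m
    i₁≡ : toℕ i₁ ≡ suc (toℕ i₀)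
    i₁≡ = toℕ-fromℕ< i₀<m

  alongSpine : ∀ d (s : Fin m) → toℕ s ≡ 0 → (j₀ j : Fin n) → toℕ j ≡ toℕ j₀ + d → Within n m (s , j₀) (s , j) d
  alongSpine zero s _ j₀ j j≡ =
    subst (λ x → Within n m (s , j₀) (s , x) 0) (toℕ-injective (trans (sym (+-identityʳ _)) (sym j≡))) here
  alongSpine (suc d) s s≡0 j₀ j j≡ =
    step (inj₁ (spine s j₀ j₁ s≡0 (sym j₁≡))) (alongSpine d s s≡0 j₁ j (trans j≡ (trans (+-suc _ d) (cong (_+ d) (sym j₁≡)))))
    where
    j₀<n : suc (toℕ j₀) < n
    j₀<n = ≤-<-trans (subst (suc (toℕ j₀) ≤_) (sym (trans j≡ (+-suc (toℕ j₀) d))) (s≤s (m≤m+n (toℕ j₀) d))) (toℕ<n j)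
    j₁ : Fin n
    j₁ = fromℕ< j₀<n
    j₁≡ : toℕ j₁ ≡ suc (toℕ j₀)
    j₁≡ = toℕ-fromℕ< j₀<n

radius< : ∀ {k} (t : Fin k) → k ∸ suc (toℕ t) < k
radius< {suc k} t = s≤s (m∸n≤m k (toℕ t))

-- The first N of the N + R sources burn for at least R rounds; the last R are arbitrary.
cover⇒Burns : ∀ {n m} N R → CombV n m → (w : Fin N → CombV n m) →
              ((u : CombV n m) → ∃ λ t → Within n m (w t) u R) → Burns n m (N + R)
cover⇒Burns {n} {m} N R default w covers = sources , λ u → let (t , walk) = covers u in
  t ↑ˡ R , subst (λ x → Within n m x u _) (sym (sources-↑ˡ t)) (Within-mono walk (R≤radius t))
  where
  sources : Fin (N + R) → CombV n m
  sources t = [ w , (λ _ → default) ]′ (splitAt N t)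
  sources-↑ˡ : ∀ t → sources (t ↑ˡ R) ≡ w t
  sources-↑ˡ t rewrite splitAt-↑ˡ N t R = refl
  R≤radius : ∀ (t : Fin N) → R ≤ N + R ∸ suc (toℕ (t ↑ˡ R))
  R≤radius t rewrite toℕ-↑ˡ t R = subst (R ≤_) (sym (+-∸-comm R (toℕ<n t))) (m≤n+m R _)

-- Counting points of an initial segment

countBelow : (ℕ → Bool) → ℕ → ℕ
countBelow f zero    = 0
countBelow f (suc N) = if f N then suc (countBelow f N) else countBelow f N

countBelow-all : ∀ f N → (∀ p → p < N → T (f p)) → N ≤ countBelow f N
countBelow-all f zero    _   = z≤n
countBelow-all f (suc N) all with f N | all N ≤-refl
... | true | _ = s≤s (countBelow-all f N (λ p p<N → all p (m<n⇒m<1+n p<N)))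

countBelow-false : ∀ N → countBelow (λ _ → false) N ≡ 0
countBelow-false zero    = refl
countBelow-false (suc N) = countBelow-false N

countBelow-∨ : ∀ f g N → countBelow (λ p → f p ∨ g p) N ≤ countBelow f N + countBelow g N
countBelow-∨ f g zero = z≤n
countBelow-∨ f g (suc N) with f N | g N
... | true  | true  = s≤s (≤-trans (countBelow-∨ f g N) (+-monoʳ-≤ _ (n≤1+n _)))
... | true  | false = s≤s (countBelow-∨ f g N)
... | false | true  = subst (suc (countBelow (λ p → f p ∨ g p) N) ≤_) (sym (+-suc (countBelow f N) (countBelow g N))) (s≤s (countBelow-∨ f g N))
... | false | false = countBelow-∨ f g N

near : ℕ → ℕ → ℕ → Bool
near B a p = ∣ a - p ∣ <ᵇ B

-- The first bound is the inductive invariant; the second is the one wanted.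
countBelow-near : ∀ B a N → countBelow (near B a) N ≤ N + B ∸ a × countBelow (near B a) N ≤ B + B
countBelow-near B a zero = z≤n , z≤n
countBelow-near B a (suc N) with near B a N in eq | countBelow-near B a N
... | false | (≤N+B∸a , ≤2B) = ≤-trans ≤N+B∸a (∸-monoˡ-≤ a (n≤1+n _)) , ≤2B
... | true  | (≤N+B∸a , _) = ≤suc , ≤-trans ≤suc suc≤2B
  where
  a-N<B : ∣ a - N ∣ < B
  a-N<B = <ᵇ⇒< _ B (subst T (sym eq) _)
  a≤N+B : a ≤ N + B
  a≤N+B = ≤-trans (m≤n+∣m-n∣ a N) (+-monoʳ-≤ N (<⇒≤ a-N<B))
  N<a+B : suc N ≤ a + B
  N<a+B = ≤-<-trans (m≤n+∣m-n∣ N a) (+-monoʳ-< a (subst (_< B) (∣-∣-comm a N) a-N<B))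
  ≤suc : suc (countBelow (near B a) N) ≤ suc N + B ∸ a
  ≤suc = subst (suc (countBelow (near B a) N) ≤_) (sym (+-∸-assoc 1 a≤N+B)) (s≤s ≤N+B∸a)
  suc≤2B : suc N + B ∸ a ≤ B + B
  suc≤2B = ≤-trans (∸-monoˡ-≤ a (+-monoˡ-≤ B N<a+B))
                   (≤-reflexive (trans (cong (_∸ a) (+-assoc a B B)) (m+n∸m≡n a (B + B))))

nearAny : ∀ {k} → ℕ → (Fin k → ℕ) → ℕ → Bool
nearAny {zero}  B a p = false
nearAny {suc k} B a p = near B (a zero) p ∨ nearAny B (a ∘ suc) p

nearAny-intro : ∀ {k} B (a : Fin k → ℕ) {p} (t : Fin k) → ∣ a t - p ∣ < B → T (nearAny B a p)
nearAny-intro B a zero    a-p<B = Equivalence.from T-∨ (inj₁ (<⇒<ᵇ a-p<B))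
nearAny-intro B a (suc t) a-p<B = Equivalence.from T-∨ (inj₂ (nearAny-intro B (a ∘ suc) t a-p<B))

countBelow-nearAny : ∀ {k} B (a : Fin k → ℕ) N → countBelow (nearAny B a) N ≤ k * (B + B)
countBelow-nearAny {zero}  B a N = ≤-reflexive (countBelow-false N)
countBelow-nearAny {suc k} B a N =
  ≤-trans (countBelow-∨ (near B (a zero)) (nearAny B (a ∘ suc)) N)
          (+-mono-≤ (proj₂ (countBelow-near B (a zero) N)) (countBelow-nearAny B (a ∘ suc) N))

coveredByWindows⇒≤ : ∀ {k B N} (a : Fin k → ℕ) →
                      (∀ p → p < N → ∃ λ t → ∣ a t - p ∣ < B) → N ≤ k * (B + B)
coveredByWindows⇒≤ {k} {B} {N} a covered =
  ≤-trans (countBelow-all (nearAny B a) N (λ p p<N → let (t , a-p<B) = covered p p<N in nearAny-intro B a t a-p<B))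
          (countBelow-nearAny B a N)

-- Lower bounds on burning sequences

spineBound : ∀ {n m b} → Burns n (suc m) b → n ≤ b * (b + b)
spineBound {n} {m} {b} (v , covers) = coveredByWindows⇒≤ (toothOf ∘ v) nearSource
  where
  nearSource : ∀ p → p < n → ∃ λ t → ∣ toothOf (v t) - p ∣ < b
  nearSource p p<n with covers (zero , fromℕ< p<n)
  ... | t , walk = t , subst (λ x → ∣ toothOf (v t) - x ∣ < b) (toℕ-fromℕ< p<n)
                             (≤-<-trans (Within-∣toothOf∣≤ walk) (radius< t))

-- The vertex (b + p % D , p / D) is reached only from its own tooth p / D, so the key
-- tooth * D + depth of its source lies within 2b of p.
deepBound : ∀ {n m b} D .{{_ : NonZero D}} → b + D ≤ m → Burns n m b → n * D ≤ b * ((b + b) + (b + b))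
deepBound {n} {m} {b} D b+D≤m (v , covers) = coveredByWindows⇒≤ key nearKey
  where
  key : Fin b → ℕ
  key t = toothOf (v t) * D + depthOf (v t)
  nearKey : ∀ p → p < n * D → ∃ λ t → ∣ key t - p ∣ < b + b
  nearKey p p<nD = t , (begin-strict
      ∣ key t - p ∣                  ≡⟨ cong₂ (λ x y → ∣ x * D + i₀ - y ∣) sameTooth p≡ ⟩
      ∣ j * D + i₀ - j * D + s ∣     ≡⟨ ∣m+n-m+o∣≡∣n-o∣ (j * D) i₀ s ⟩
      ∣ i₀ - s ∣                     ≤⟨ ∣-∣-triangle i₀ (b + s) s ⟩
      ∣ i₀ - b + s ∣ + ∣ b + s - s ∣ ≡⟨ cong (∣ i₀ - b + s ∣ +_) (trans (∣-∣-comm (b + s) s) (trans (cong (∣ s -_∣) (+-comm b s)) (∣m-m+n∣≡n s b))) ⟩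
      ∣ i₀ - b + s ∣ + b             <⟨ +-monoˡ-< b (≤-<-trans i₀-depth≤r (radius< t)) ⟩
      b + b                          ∎)
    where
    open ≤-Reasoning
    j = p / D
    s = p % D
    j<n : j < n
    j<n = m<n*o⇒m/o<n p<nD
    b+s<m : b + s < m
    b+s<m = <-≤-trans (+-monoʳ-< b (m%n<n p D)) b+D≤m
    target : CombV n m
    target = fromℕ< b+s<m , fromℕ< j<n
    t = proj₁ (covers target)
    walk = proj₂ (covers target)
    r = b ∸ suc (toℕ t)
    i₀ = depthOf (v t)
    depth≡ : depthOf target ≡ b + s
    depth≡ = toℕ-fromℕ< b+s<m
    i₀-depth≤r : ∣ i₀ - b + s ∣ ≤ r
    i₀-depth≤r = subst (λ x → ∣ i₀ - x ∣ ≤ r) depth≡ (Within-∣depthOf∣≤ walk)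
    sameTooth : toothOf (v t) ≡ j
    sameTooth with toothOf (v t) ≟ toothOf target
    ... | yes ≡target = trans ≡target (toℕ-fromℕ< j<n)
    ... | no ≢target = ⊥-elim (<-irrefl refl (begin-strict
          b                ≤⟨ m≤m+n b s ⟩
          b + s            ≡⟨ depth≡ ⟨
          depthOf target   <⟨ Within-acrossTeeth⇒depth< walk ≢target ⟩
          r                <⟨ radius< t ⟩
          b                ∎))
    p≡ : p ≡ j * D + s
    p≡ = trans (m≡m%n+[m/n]*n p D) (+-comm s (j * D))

2m≤3[m∸b] : ∀ {b m} → 3 * b < m → 2 * m ≤ 3 * (m ∸ b)
2m≤3[m∸b] {b} {m} 3b<m = begin
    2 * m          ≡⟨ cong (2 *_) (m+[n∸m]≡n b≤m) ⟨
    2 * (b + D)    ≡⟨ *-distribˡ-+ 2 b D ⟩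
    2 * b + 2 * D  ≤⟨ +-monoˡ-≤ (2 * D) (<⇒≤ 2b<D) ⟩
    3 * D          ∎
  where
  open ≤-Reasoning
  D = m ∸ b
  b≤m : b ≤ m
  b≤m = ≤-trans (m≤m+n b (2 * b)) (<⇒≤ 3b<m)
  2b<D : 2 * b < D
  2b<D = +-cancelˡ-< b (2 * b) D (subst (3 * b <_) (sym (m+[n∸m]≡n b≤m)) 3b<m)

longTeeth⇒nm≤6b² : ∀ {n m b} → 3 * b < m → Burns n m b → n * m ≤ 6 * (b * b)
longTeeth⇒nm≤6b² {n} {m} {b} 3b<m burns = *-cancelˡ-≤ 2 (begin
    2 * (n * m)                ≡⟨ 2[nm]≡n[2m] n m ⟩
    n * (2 * m)                ≤⟨ *-monoʳ-≤ n (2m≤3[m∸b] {b} 3b<m) ⟩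
    n * (3 * D)                ≡⟨ n[3D]≡3[nD] n D ⟩
    3 * (n * D)                ≤⟨ *-monoʳ-≤ 3 (deepBound D (≤-reflexive (m+[n∸m]≡n b≤m)) burns) ⟩
    3 * (b * ((b + b) + (b + b))) ≡⟨ 12b²≡2[6b²] b ⟩
    2 * (6 * (b * b))          ∎)
  where
  open ≤-Reasoning
  D = m ∸ b
  b≤m : b ≤ m
  b≤m = ≤-trans (m≤m+n b (2 * b)) (<⇒≤ 3b<m)
  instance
    D≢0 : NonZero D
    D≢0 = >-nonZero (m<n⇒0<n∸m (≤-<-trans (m≤m+n b (2 * b)) 3b<m))
  2[nm]≡n[2m] : ∀ n m → 2 * (n * m) ≡ n * (2 * m)
  2[nm]≡n[2m] = solve-∀
  n[3D]≡3[nD] : ∀ n D → n * (3 * D) ≡ 3 * (n * D)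
  n[3D]≡3[nD] = solve-∀
  12b²≡2[6b²] : ∀ b → 3 * (b * ((b + b) + (b + b))) ≡ 2 * (6 * (b * b))
  12b²≡2[6b²] = solve-∀

-- Burning sequences

clampFin : ∀ {k} → ℕ → Fin (suc k)
clampFin {k} x with x <? suc k
... | yes x<k = fromℕ< x<k
... | no _    = zero

toℕ-clampFin-block : ∀ {k} S .{{_ : NonZero S}} (x : Fin (suc k)) →
                     toℕ x ≡ toℕ (clampFin {k} (toℕ x / S * S)) + toℕ x % S
toℕ-clampFin-block {k} S x = trans (m≡m%n+[m/n]*n (toℕ x) S) (trans (+-comm _ (toℕ x / S * S)) (cong (_+ toℕ x % S) (sym clamped)))
  where
  clamped : toℕ (clampFin {k} (toℕ x / S * S)) ≡ toℕ x / S * S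
  clamped with toℕ x / S * S <? suc k
  ... | yes lt = toℕ-fromℕ< lt
  ... | no x≮k = ⊥-elim (x≮k (≤-<-trans (m/n*n≤m (toℕ x) S) (toℕ<n x)))

spineSources : ∀ {n m} h .{{_ : NonZero h}} → suc m ≤ h → suc n ≤ h * h → Burns (suc n) (suc m) (h + 2 * h)
spineSources {n} {m} h m<h n<h² = cover⇒Burns h (2 * h) (zero , zero) sources covers
  where
  sources : Fin h → CombV (suc n) (suc m)
  sources t = zero , clampFin (toℕ t * h)
  covers : (u : CombV (suc n) (suc m)) → ∃ λ t → Within (suc n) (suc m) (sources t) u (2 * h)
  covers (i , j) = fromℕ< q<h , subst (λ x → Within (suc n) (suc m) (zero , clampFin (x * h)) (i , j) (2 * h))
                                      (sym (toℕ-fromℕ< q<h)) walk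
    where
    q<h : toℕ j / h < h
    q<h = m<n*o⇒m/o<n (<-≤-trans (toℕ<n j) n<h²)
    walk : Within (suc n) (suc m) (zero , clampFin (toℕ j / h * h)) (i , j) (2 * h)
    walk = Within-mono (Within-++ (alongSpine (toℕ j % h) zero refl _ j (toℕ-clampFin-block h j)) (climb (toℕ i) j zero i refl))
                       (≤-trans (+-mono-≤ (<⇒≤ (m%n<n (toℕ j) h)) (≤-trans (<⇒≤ (toℕ<n i)) m<h))
                                (≤-reflexive (cong (h +_) (sym (+-identityʳ h)))))

toothSources : ∀ {n m} S Q .{{_ : NonZero S}} → suc m ≤ Q * S → Burns (suc n) (suc m) (suc n * Q + S)
toothSources {n} {m} S Q m<QS = cover⇒Burns (suc n * Q) S (zero , zero) sources covers
  where
  sources : Fin (suc n * Q) → CombV (suc n) (suc m)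
  sources t = clampFin (toℕ (proj₂ (remQuot Q t)) * S) , proj₁ (remQuot Q t)
  covers : (u : CombV (suc n) (suc m)) → ∃ λ t → Within (suc n) (suc m) (sources t) u S
  covers (i , j) = combine j (fromℕ< q<Q) ,
    subst (λ x → Within (suc n) (suc m) (clampFin (toℕ (proj₂ x) * S) , proj₁ x) (i , j) S) (sym (remQuot-combine j (fromℕ< q<Q)))
      (subst (λ x → Within (suc n) (suc m) (clampFin (x * S) , j) (i , j) S) (sym (toℕ-fromℕ< q<Q)) walk)
    where
    q<Q : toℕ i / S < Q
    q<Q = m<n*o⇒m/o<n (<-≤-trans (toℕ<n i) m<QS)
    walk : Within (suc n) (suc m) (clampFin (toℕ i / S * S) , j) (i , j) S
    walk = Within-mono (climb (toℕ i % S) j _ i (toℕ-clampFin-block S i)) (<⇒≤ (m%n<n (toℕ i) S))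

-- Square roots and the three regimes

sqrt-bracket : ∀ N → ∃[ S ] suc N ≤ S * S × S * S ≤ 4 * suc N
sqrt-bracket zero = 1 , ≤-refl , s≤s z≤n
sqrt-bracket (suc N) with sqrt-bracket N
... | S , N<S² , S²≤4N with suc (suc N) ≤? S * S
...   | yes N+1<S² = S , N+1<S² , ≤-trans S²≤4N (*-monoʳ-≤ 4 (n≤1+n (suc N)))
...   | no N+1≮S² = suc S , subst (_≤ suc S * suc S) (cong suc S²≡N+1) (s≤s (≤-trans (*-monoʳ-≤ S (n≤1+n S)) (m≤n+m _ S))) , (begin
          suc S * suc S                                    ≡⟨ square-suc S ⟩
          S * S + S + S + 1                                ≤⟨ +-monoˡ-≤ 1 (+-mono-≤ (+-monoʳ-≤ (S * S) (S≤S²+1 S)) (S≤S²+1 S)) ⟩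
          S * S + (S * S + 1) + (S * S + 1) + 1            ≤⟨ m≤m+n _ (S * S + 1) ⟩
          S * S + (S * S + 1) + (S * S + 1) + 1 + (S * S + 1) ≡⟨ four-suc S ⟩
          4 * suc (S * S)                                  ≡⟨ cong (λ x → 4 * suc x) S²≡N+1 ⟩
          4 * suc (suc N)                                  ∎)
  where
  open ≤-Reasoning
  S²≡N+1 : S * S ≡ suc N
  S²≡N+1 = ≤-antisym (≤-pred (≰⇒> N+1≮S²)) N<S²
  S≤S²+1 : ∀ S → S ≤ S * S + 1
  S≤S²+1 zero    = z≤n
  S≤S²+1 (suc S) = ≤-trans (m≤m+n (suc S) (S * suc S)) (m≤m+n _ 1)
  square-suc : ∀ S → suc S * suc S ≡ S * S + S + S + 1
  square-suc = solve-∀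
  four-suc : ∀ S → S * S + (S * S + 1) + (S * S + 1) + 1 + (S * S + 1) ≡ 4 * suc (S * S)
  four-suc = solve-∀

m*m≤n*n⇒m≤n : ∀ {a c} → a * a ≤ c * c → a ≤ c
m*m≤n*n⇒m≤n a²≤c² = ≮⇒≥ (λ c<a → <⇒≱ (*-mono-< c<a c<a) a²≤c²)

square-3*≡9* : ∀ S → (3 * S) * (3 * S) ≡ 9 * (S * S)
square-3*≡9* = solve-∀

b≤3S⇒b²≤36N : ∀ {b S} N → b ≤ 3 * S → S * S ≤ 4 * N → b * b ≤ 36 * N
b≤3S⇒b²≤36N {b} {S} N b≤3S S²≤4N = begin
  b * b              ≤⟨ *-mono-≤ b≤3S b≤3S ⟩
  (3 * S) * (3 * S)  ≡⟨ square-3*≡9* S ⟩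
  9 * (S * S)        ≤⟨ *-monoʳ-≤ 9 S²≤4N ⟩
  9 * (4 * N)        ≡⟨ *-assoc 9 4 N ⟨
  36 * N             ∎
  where open ≤-Reasoning

IsBurningNumber⇒≤ : ∀ {n m b k} → IsBurningNumber n m b → Burns n m k → b ≤ k
IsBurningNumber⇒≤ (_ , minimal) burns = ≮⇒≥ (λ k<b → minimal _ k<b burns)

module _ {n m b : ℕ} (burning : IsBurningNumber (suc n) (suc m) b) where

  shortTeeth : suc m * suc m ≤ suc n → suc n ≤ 9 * (b * b) × b * b ≤ 36 * suc n
  shortTeeth m²≤n = lower , upper
    where
    lower : suc n ≤ 9 * (b * b)
    lower = begin
      suc n        ≤⟨ spineBound (proj₁ burning) ⟩
      b * (b + b)  ≡⟨ b[b+b]≡2b² b ⟩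
      2 * (b * b)  ≤⟨ *-monoˡ-≤ (b * b) {2} {9} (s≤s (s≤s z≤n)) ⟩
      9 * (b * b)  ∎
      where
      open ≤-Reasoning
      b[b+b]≡2b² : ∀ b → b * (b + b) ≡ 2 * (b * b)
      b[b+b]≡2b² = solve-∀
    upper : b * b ≤ 36 * suc n
    upper with sqrt-bracket n
    ... | S@(suc _) , N≤S² , S²≤4N =
      b≤3S⇒b²≤36N (suc n) (IsBurningNumber⇒≤ burning (spineSources S (m*m≤n*n⇒m≤n (≤-trans m²≤n N≤S²)) N≤S²)) S²≤4N

  mediumTeeth : suc n ≤ suc m * suc m → suc m ≤ suc n → suc m ≤ 3 * b × b ≤ 6 * suc m
  mediumTeeth n≤m² m≤n = ≮⇒≥ long⇒⊥ , ≤-trans (IsBurningNumber⇒≤ burning (spineSources (suc m) ≤-refl n≤m²))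
                                               (*-monoˡ-≤ (suc m) {3} {6} (s≤s (s≤s (s≤s z≤n))))
    where
    long⇒⊥ : 3 * b < suc m → ⊥
    long⇒⊥ 3b<m = <⇒≱ (begin-strict
        6 * (b * b)        ≤⟨ *-monoˡ-≤ (b * b) {6} {9} (s≤s (s≤s (s≤s (s≤s (s≤s (s≤s z≤n)))))) ⟩
        9 * (b * b)        ≡⟨ square-3*≡9* b ⟨
        (3 * b) * (3 * b)  <⟨ *-mono-< 3b<m 3b<m ⟩
        suc m * suc m      ≤⟨ *-monoˡ-≤ (suc m) m≤n ⟩
        suc n * suc m      ∎) (longTeeth⇒nm≤6b² 3b<m (proj₁ burning))
      where open ≤-Reasoning

  longTeeth : suc n ≤ suc m → suc n * suc m ≤ 9 * (b * b) × b * b ≤ 36 * (suc n * suc m)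
  longTeeth n≤m = lower , upper
    where
    lower : suc n * suc m ≤ 9 * (b * b)
    lower with suc m ≤? 3 * b
    ... | yes m≤3b = ≤-trans (*-monoˡ-≤ (suc m) n≤m) (≤-trans (*-mono-≤ m≤3b m≤3b) (≤-reflexive (square-3*≡9* b)))
    ... | no m≰3b = ≤-trans (longTeeth⇒nm≤6b² (≰⇒> m≰3b) (proj₁ burning)) (*-monoˡ-≤ (b * b) {6} {9} (s≤s (s≤s (s≤s (s≤s (s≤s (s≤s z≤n)))))))
    upper : b * b ≤ 36 * (suc n * suc m)
    upper with sqrt-bracket (m + n * suc m)
    ... | S@(suc _) , nm≤S² , S²≤4nm = b≤3S⇒b²≤36N (suc n * suc m) (≤-trans (IsBurningNumber⇒≤ burning (toothSources S Q m<QS)) nQ+S≤3S) S²≤4nm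
      where
      Q = suc (suc m / S)
      m<QS : suc m ≤ Q * S
      m<QS = subst (_≤ Q * S) (sym (m≡m%n+[m/n]*n (suc m) S)) (+-monoˡ-≤ (suc m / S * S) (<⇒≤ (m%n<n (suc m) S)))
      n≤S : suc n ≤ S
      n≤S = m*m≤n*n⇒m≤n (≤-trans (*-monoʳ-≤ (suc n) n≤m) nm≤S²)
      n[m/S]≤S : suc n * (suc m / S) ≤ S
      n[m/S]≤S = *-cancelʳ-≤ (suc n * (suc m / S)) S S (begin
        suc n * (suc m / S) * S  ≡⟨ *-assoc (suc n) (suc m / S) S ⟩
        suc n * (suc m / S * S)  ≤⟨ *-monoʳ-≤ (suc n) (m/n*n≤m (suc m) S) ⟩
        suc n * suc m            ≤⟨ nm≤S² ⟩
        S * S                    ∎)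
        where open ≤-Reasoning
      nQ+S≤3S : suc n * Q + S ≤ 3 * S
      nQ+S≤3S = begin
        suc n * Q + S                      ≡⟨ cong (_+ S) (*-suc (suc n) (suc m / S)) ⟩
        suc n + suc n * (suc m / S) + S    ≤⟨ +-monoˡ-≤ S (+-mono-≤ n≤S n[m/S]≤S) ⟩
        S + S + S                          ≡⟨ S+S+S≡3S S ⟩
        3 * S                              ∎
        where
        open ≤-Reasoning
        S+S+S≡3S : ∀ S → S + S + S ≡ 3 * S
        S+S+S≡3S = solve-∀

corollaryA1 : ∃ λ (K : ℕ) → ∃ λ (C : ℕ) → 1 ≤ K × 1 ≤ C ×
    ((n m b : ℕ) → 1 ≤ n → 1 ≤ m → IsBurningNumber n m b →
      ((m * m ≤ n → n ≤ (K * K) * (b * b) × b * b ≤ (C * C) * n)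
      × (n ≤ m * m → m ≤ n → m ≤ K * b × b ≤ C * m)
      × (n ≤ m → n * m ≤ (K * K) * (b * b) × b * b ≤ (C * C) * (n * m))))
corollaryA1 = 3 , 6 , s≤s z≤n , s≤s z≤n , λ where
  (suc n) (suc m) b _ _ burning → shortTeeth burning , mediumTeeth burning , longTeeth burning
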